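{- Let $H$ be a graph of type $(t,K_3)$ for some integer $t\geq 0$, and let $C(H)$ be the graph formed by the cut-edges of $H$. Then: (1) if $t=1$ and $|E(C(H))|=1$, then $\mathrm{lec}(H)=2$; (2) if $t\leq 2$ and $|E(C(H))|\geq 2$, then $\mathrm{lec}(H)=3$; (3) if $t\geq 3$, then $t\leq \mathrm{lec}(H)\leq t+1$; moreover $\mathrm{lec}(H)=t+1$ if and only if $H$ contains two vertices $b_1,b_2$ with $\deg_{C(H)}(b_1)+\deg_{C(H)}(b_2)\geq 2t-1$.
   Context: Graphs are finite, simple. For a graph $F$ and integer $t\geq0$, $F_t$ is the graph obtained from $F$ by attaching $t$ new pendant vertices (leaves) to every vertex of $F$. For a $2$-connected graph $F$, a non-trivial connected graph $H$ is of type $(t,F)$ if $F\subseteq H\subseteq F_t$ (i.e. $H$ consists of $F$ together with some of the pendant edges of $F_t$) and some vertex of $H$ is adjacent to exactly $t$ leaves. $C(H)$ is the graph whose edges are the cut-edges of $H$ and whose vertices are their endpoints; $\deg_{C(H)}(b)$ is the number of cut-edges at $b$. Given an edge-colouring $\varphi:E(H)\to[1,k]$, a path is loose if it consists of exactly one edge, or of exactly two edges of different colours, or has at least three edges coloured with at least three distinct colours. $\mathrm{lec}(H)$ is the least $k$ for which there is an edge-colouring with $k$ colours such that every two distinct vertices are joined by a loose path. -}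

module Defs where

open import Data.Nat using (ℕ; suc; _≤_)
open import Data.Fin using (Fin)
open import Data.List using (List; []; _∷_; length)
open import Data.List.Membership.Propositional using (_∈_; _∉_)
open import Data.List.Relation.Unary.Unique.Propositional using (Unique)
open import Data.Product using (Σ; ∃; _×_; _,_)
open import Data.Sum using (_⊎_; inj₁; inj₂)
open import Data.Empty using (⊥)
open import Relation.Nullary using (¬_)
open import Relation.Binary.PropositionalEquality using (_≡_; _≢_; refl; sym)
open import Function.Bundles using (_⇔_)

record Graph : Set₁ where
  field
    V       : Set
    _~_     : V → V → Set
    ~-sym   : ∀ {u v} → u ~ v → v ~ u
    ~-irrefl : ∀ {v} → ¬ (v ~ v)

module _ (G : Graph) where
  open Graph G

  data Walk : V → V → Set where
    [_]  : ∀ v → Walk v v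
    step : ∀ {u v w} → u ~ v → Walk v w → Walk u w

  vertices : ∀ {u w} → Walk u w → List V
  vertices [ v ] = v ∷ []
  vertices (step {u} _ p) = u ∷ vertices p

  edgeColours : ∀ {k u w} → (V → V → Fin k) → Walk u w → List (Fin k)
  edgeColours c [ v ] = []
  edgeColours c (step {u} {v} _ p) = c u v ∷ edgeColours c p

  IsPath : ∀ {u w} → Walk u w → Set
  IsPath p = Unique (vertices p)

Loose : ∀ {k} → List (Fin k) → Set
Loose cs =
  (length cs ≡ 1)
  ⊎ (Σ _ λ x → Σ _ λ y → (cs ≡ x ∷ y ∷ []) × x ≢ y)
  ⊎ ((3 ≤ length cs) ×
     (Σ _ λ x → Σ _ λ y → Σ _ λ z →
        x ∈ cs × y ∈ cs × z ∈ cs × x ≢ y × x ≢ z × y ≢ z))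

IsLooseColouring : (G : Graph) (k : ℕ) → (Graph.V G → Graph.V G → Fin k) → Set
IsLooseColouring G k c =
  (∀ u v → c u v ≡ c v u) ×
  (∀ u v → u ≢ v →
     Σ (Walk G u v) λ p → IsPath G p × Loose (edgeColours G c p))

HasLooseColouring : Graph → ℕ → Set
HasLooseColouring G k = Σ (Graph.V G → Graph.V G → Fin k) (IsLooseColouring G k)

IsLec : Graph → ℕ → Set
IsLec G k = HasLooseColouring G k × (∀ j → HasLooseColouring G j → k ≤ j)

removeEdge : (G : Graph) → Graph.V G → Graph.V G → Graph
removeEdge G u v = record
  { V = V
  ; _~_ = λ x y → (x ~ y) × ¬ (((x ≡ u) × (y ≡ v)) ⊎ ((x ≡ v) × (y ≡ u)))
  ; ~-sym = λ { (xy , ne) → ~-sym xy , λ { (inj₁ (a , b)) → ne (inj₂ (b , a))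
                                         ; (inj₂ (a , b)) → ne (inj₁ (b , a)) } }
  ; ~-irrefl = λ { (xx , _) → ~-irrefl xx }
  }
  where open Graph G

IsCutEdge : (G : Graph) → Graph.V G → Graph.V G → Set
IsCutEdge G u v = Graph._~_ G u v × ¬ Walk (removeEdge G u v) u v

CutDeg : (G : Graph) → Graph.V G → ℕ → Set
CutDeg G b d =
  Σ (List (Graph.V G)) λ xs →
    Unique xs × (∀ w → (w ∈ xs) ⇔ IsCutEdge G b w) × (length xs ≡ d)

NumCutEdges : (G : Graph) → ℕ → Set
NumCutEdges G m =
  Σ (List (Graph.V G × Graph.V G)) λ xs →
    Unique xs
    × (∀ u v → (u , v) ∈ xs → IsCutEdge G u v)
    × (∀ u v → IsCutEdge G u v → ((u , v) ∈ xs) ⊎ ((v , u) ∈ xs))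
    × (∀ u v → (u , v) ∈ xs → (v , u) ∉ xs)
    × (length xs ≡ m)

-- Graphs H with K₃ ⊆ H ⊆ (K₃)_t : the triangle on Fin 3, where
-- triangle vertex i carries a i pendant leaves.

K3V : (Fin 3 → ℕ) → Set
K3V a = Fin 3 ⊎ Σ (Fin 3) (λ i → Fin (a i))

data K3Adj (a : Fin 3 → ℕ) : K3V a → K3V a → Set where
  tri   : ∀ {i j} → i ≢ j → K3Adj a (inj₁ i) (inj₁ j)
  hang  : ∀ {i l} → K3Adj a (inj₁ i) (inj₂ (i , l))
  hang′ : ∀ {i l} → K3Adj a (inj₂ (i , l)) (inj₁ i)

K3Adj-sym : ∀ {a x y} → K3Adj a x y → K3Adj a y x
K3Adj-sym (tri ne) = tri (λ e → ne (sym e))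
K3Adj-sym hang = hang′
K3Adj-sym hang′ = hang

K3Adj-irrefl : ∀ {a x} → ¬ K3Adj a x x
K3Adj-irrefl (tri ne) = ne refl

K3Leaves : (Fin 3 → ℕ) → Graph
K3Leaves a = record
  { V = K3V a ; _~_ = K3Adj a ; ~-sym = K3Adj-sym ; ~-irrefl = K3Adj-irrefl }

IsTypeK3 : ℕ → (Fin 3 → ℕ) → Set
IsTypeK3 t a = (∀ i → a i ≤ t) × (∃ λ i → a i ≡ t)

TwoHeavy : Graph → ℕ → Set
TwoHeavy G t =
  Σ (Graph.V G) λ b₁ → Σ (Graph.V G) λ b₂ → b₁ ≢ b₂ ×
  Σ ℕ λ d₁ → Σ ℕ λ d₂ → CutDeg G b₁ d₁ × CutDeg G b₂ d₂ ×
  (2 Data.Nat.* t Data.Nat.∸ 1 ≤ d₁ Data.Nat.+ d₂)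

-- The cut-edges of H are exactly its pendant edges, so deg_C is a i at root i and 1 at a leaf.
--
-- The only path between two leaves of one root has two edges, so the pendant
-- colours at a root are distinct; two distinct leaves already force three colours.  If root i
-- carries t ≥ 2 leaves and root j at least t - 1, then t colours do not suffice: the pendant
-- colours at i would use the whole palette, so every pendant colour at j recurs at i, and the
-- path between two such leaves is loose only by detouring through the third root, whose two
-- triangle edges then need two colours not used at j.
--
-- Colour the triangle edge opposite root i with colour i, and give the pendant
-- edges of each root distinct colours so that a colour shared by roots i and j is neither
-- colour i nor colour j.  With t + 1 colours every root avoids its opposite colour; with t
-- colours this is possible when no two roots are heavy, since then all roots but the fullest
-- carry at most t - 2 leaves.

{-# OPTIONS --safe #-}
module Submission where

open import Defs
open import Data.Nat using (ℕ; zero; suc; _≤_; _+_; _*_; _∸_; z≤n; s≤s; _≤?_)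
open import Data.Nat.Properties
open import Data.Fin as Fin using (Fin; zero; suc; punchIn; punchOut; inject≤)
import Data.Fin.Properties as Finₚ
open import Data.List using (List; []; _∷_; length; lookup; tabulate; allFin)
open import Data.List.Properties using (length-tabulate)
open import Data.List.Membership.Propositional using (_∈_; _∉_)
open import Data.List.Membership.Propositional.Properties using (∈-lookup; ∈-allFin; ∈-tabulate⁺; ∈-tabulate⁻)
open import Data.List.Membership.Setoid.Properties using (index-injective)
open import Data.List.Relation.Binary.Subset.Propositional using (_⊆_)
open import Data.List.Relation.Unary.Any as Any using (here; there)
import Data.List.Relation.Unary.All as All
open import Data.List.Relation.Unary.AllPairs using ([]; _∷_)
open import Data.List.Relation.Unary.All using (All; []; _∷_)
open import Data.List.Relation.Unary.Unique.Propositional using (Unique)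
open import Data.List.Relation.Unary.Unique.Propositional.Properties using (tabulate⁺)
open import Data.Product using (Σ; ∃; ∃₂; _×_; _,_; proj₁; proj₂)
open import Data.Sum using (_⊎_; inj₁; inj₂)
open import Data.Sum.Properties using (inj₁-injective)
open import Data.Empty using (⊥; ⊥-elim)
open import Function using (_∘_; case_of_)
open import Function.Bundles using (_⇔_; mk⇔; Equivalence)
open import Function.Definitions using (Injective)
open import Relation.Nullary using (¬_; yes; no; Dec)
open import Relation.Nullary.Decidable using (_×-dec_; ¬?)
open import Relation.Binary.PropositionalEquality
  using (_≡_; _≢_; refl; sym; trans; cong; subst; ≢-sym; setoid)

Unique⇒lookup-injective : ∀ {A : Set} {xs : List A} → Unique xs → Injective _≡_ _≡_ (lookup xs)
Unique⇒lookup-injective (_ ∷ _) {zero} {zero} _ = refl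
Unique⇒lookup-injective (x∉xs ∷ _) {zero} {suc q} e = ⊥-elim (All.lookup x∉xs (∈-lookup q) e)
Unique⇒lookup-injective (x∉xs ∷ _) {suc p} {zero} e = ⊥-elim (All.lookup x∉xs (∈-lookup p) (sym e))
Unique⇒lookup-injective (_ ∷ xs-unique) {suc p} {suc q} e = cong suc (Unique⇒lookup-injective xs-unique e)

unique⊆⇒length≤ : ∀ {A : Set} {xs ys : List A} → Unique xs → xs ⊆ ys → length xs ≤ length ys
unique⊆⇒length≤ {A} {xs} {ys} xs-unique xs⊆ys = Finₚ.injective⇒≤ position-injective
  where
  position : Fin (length xs) → Fin (length ys)
  position p = Any.index (xs⊆ys (∈-lookup p))

  position-injective : Injective _≡_ _≡_ position
  position-injective e = Unique⇒lookup-injective xs-unique (index-injective (setoid A) _ _ e)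

unique⇒length≤ : ∀ {n} {xs : List (Fin n)} → Unique xs → length xs ≤ n
unique⇒length≤ xs-unique =
  ≤-trans (unique⊆⇒length≤ xs-unique (λ {x} _ → ∈-allFin x)) (≤-reflexive (length-tabulate _))

distinct-members⇒2≤length : ∀ {A : Set} {x y : A} {xs} → x ∈ xs → y ∈ xs → x ≢ y → 2 ≤ length xs
distinct-members⇒2≤length x∈xs y∈xs x≢y =
  unique⊆⇒length≤ ((x≢y ∷ []) ∷ [] ∷ []) (All.lookup (x∈xs ∷ y∈xs ∷ []))

injective⇒surjective : ∀ {m n} {f : Fin m → Fin n} → Injective _≡_ _≡_ f → n ≤ m →
  ∀ y → ∃ λ x → f x ≡ y
injective⇒surjective {m} {suc n} {f} f-injective n≤m y with Finₚ.any? (λ x → f x Fin.≟ y)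
... | yes hit = hit
... | no miss = ⊥-elim (1+n≰n (≤-trans n≤m (Finₚ.injective⇒≤ punched-injective)))
  where
  punched : Fin m → Fin n
  punched x = punchOut {i = y} (λ e → miss (x , sym e))

  punched-injective : Injective _≡_ _≡_ punched
  punched-injective {x} {x′} e =
    f-injective (Finₚ.punchOut-injective (λ e → miss (x , sym e)) (λ e → miss (x′ , sym e)) e)

¬Loose[] : ∀ {k} → ¬ Loose {k} []
¬Loose[] (inj₁ ())
¬Loose[] (inj₂ (inj₁ (_ , _ , () , _)))
¬Loose[] (inj₂ (inj₂ (() , _)))

Loose-pair⇒≢ : ∀ {k} {x y : Fin k} → Loose (x ∷ y ∷ []) → x ≢ y
Loose-pair⇒≢ (inj₁ ())
Loose-pair⇒≢ (inj₂ (inj₁ (_ , _ , refl , x≢y))) = x≢y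
Loose-pair⇒≢ (inj₂ (inj₂ (s≤s (s≤s ()) , _)))

Loose-distinct₀₁₂ : ∀ {k} {x y z : Fin k} {cs} → x ≢ y → x ≢ z → y ≢ z → Loose (x ∷ y ∷ z ∷ cs)
Loose-distinct₀₁₂ x≢y x≢z y≢z = inj₂ (inj₂ (s≤s (s≤s (s≤s z≤n)) , _ , _ , _ ,
  here refl , there (here refl) , there (there (here refl)) , x≢y , x≢z , y≢z))

Loose-distinct₁₂₃ : ∀ {k} {w x y z : Fin k} {cs} → x ≢ y → x ≢ z → y ≢ z →
  Loose (w ∷ x ∷ y ∷ z ∷ cs)
Loose-distinct₁₂₃ x≢y x≢z y≢z = inj₂ (inj₂ (s≤s (s≤s (s≤s z≤n)) , _ , _ , _ ,
  there (here refl) , there (there (here refl)) , there (there (there (here refl))) , x≢y , x≢z , y≢z))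

Loose-long⇒3≤length : ∀ {k} {x y z : Fin k} {cs} ys → x ∷ y ∷ z ∷ cs ⊆ ys → Loose (x ∷ y ∷ z ∷ cs) →
  3 ≤ length ys
Loose-long⇒3≤length ys _ (inj₁ ())
Loose-long⇒3≤length ys _ (inj₂ (inj₁ (_ , _ , () , _)))
Loose-long⇒3≤length ys ⊆ys (inj₂ (inj₂ (_ , _ , _ , _ , x∈ , y∈ , z∈ , x≢y , x≢z , y≢z))) =
  unique⊆⇒length≤ ((x≢y ∷ x≢z ∷ []) ∷ (y≢z ∷ []) ∷ [] ∷ [])
    (All.lookup (⊆ys x∈ ∷ ⊆ys y∈ ∷ ⊆ys z∈ ∷ []))

Loose-long⇒3≤ : ∀ {k} {x y z : Fin k} {cs} → Loose (x ∷ y ∷ z ∷ cs) → 3 ≤ k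
Loose-long⇒3≤ loose =
  ≤-trans (Loose-long⇒3≤length (allFin _) (λ {c} _ → ∈-allFin c) loose) (≤-reflexive (length-tabulate _))

¬Loose-dichromatic : ∀ {k} {x y z p q : Fin k} {cs} → All (_∈ p ∷ q ∷ []) (x ∷ y ∷ z ∷ cs) →
  ¬ Loose (x ∷ y ∷ z ∷ cs)
¬Loose-dichromatic in-pq loose with Loose-long⇒3≤length _ (All.lookup in-pq) loose
... | s≤s (s≤s ())

¬Loose-equal-ends₃ : ∀ {k} {x y z : Fin k} → x ≡ z → ¬ Loose (x ∷ y ∷ z ∷ [])
¬Loose-equal-ends₃ refl = ¬Loose-dichromatic (here refl ∷ there (here refl) ∷ here refl ∷ [])

Loose-equal-ends₄ : ∀ {k} {w x y z : Fin k} → w ≡ z → Loose (w ∷ x ∷ y ∷ z ∷ []) →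
  x ≢ y × w ≢ x × w ≢ y
Loose-equal-ends₄ {w = w} {x} {y} refl loose = x≢y , w≢x , w≢y
  where
  x≢y : x ≢ y
  x≢y refl = ¬Loose-dichromatic (here refl ∷ there (here refl) ∷ there (here refl) ∷ here refl ∷ []) loose
  w≢x : w ≢ x
  w≢x refl = ¬Loose-dichromatic {q = y} (here refl ∷ here refl ∷ there (here refl) ∷ here refl ∷ []) loose
  w≢y : w ≢ y
  w≢y refl = ¬Loose-dichromatic (here refl ∷ there (here refl) ∷ here refl ∷ here refl ∷ []) loose

module _ (G : Graph) where
  open Graph G

  Path : V → V → Set
  Path u v = Σ (Walk G u v) (IsPath G)

  LoosePath : ∀ {k} → (V → V → Fin k) → V → V → Set
  LoosePath c u v = Σ (Walk G u v) λ p → IsPath G p × Loose (edgeColours G c p)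

  path-loose : ∀ {k} {c : V → V → Fin k} {u v} (π : Path u v) → Loose (edgeColours G c (proj₁ π)) →
    LoosePath c u v
  path-loose (p , p-path) p-loose = p , p-path , p-loose

module _ (G : Graph) {k : ℕ} (c : Graph.V G → Graph.V G → Fin k) where
  open Graph G

  loose-nonadjacent : ∀ {u v} (p : Walk G u v) → ¬ u ~ v → Loose (edgeColours G c p) →
    3 ≤ k ⊎ Σ V λ w → u ~ w × w ~ v × c u w ≢ c w v
  loose-nonadjacent [ _ ] _ loose = ⊥-elim (¬Loose[] loose)
  loose-nonadjacent (step u~v [ _ ]) u≁v _ = ⊥-elim (u≁v u~v)
  loose-nonadjacent (step u~w (step w~v [ _ ])) _ loose = inj₂ (_ , u~w , w~v , Loose-pair⇒≢ loose)
  loose-nonadjacent (step _ (step _ (step _ _))) _ loose = inj₁ (Loose-long⇒3≤ loose)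

CutDeg-functional : ∀ (G : Graph) {b d d′} → CutDeg G b d → CutDeg G b d′ → d ≡ d′
CutDeg-functional G (xs , xs-unique , xs-cut , refl) (ys , ys-unique , ys-cut , refl) =
  ≤-antisym (unique⊆⇒length≤ xs-unique (λ {w} → from (ys-cut w) ∘ to (xs-cut w)))
            (unique⊆⇒length≤ ys-unique (λ {w} → from (xs-cut w) ∘ to (ys-cut w)))
  where open Equivalence

-- The triangle with pendant leaves

third : Fin 3 → Fin 3 → Fin 3
third zero (suc zero) = suc (suc zero)
third zero (suc (suc zero)) = suc zero
third (suc zero) zero = suc (suc zero)
third (suc zero) (suc (suc zero)) = zero
third (suc (suc zero)) zero = suc zero
third (suc (suc zero)) (suc zero) = zero
third i _ = i

third-comm : ∀ i j → third i j ≡ third j i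
third-comm zero zero = refl
third-comm zero (suc zero) = refl
third-comm zero (suc (suc zero)) = refl
third-comm (suc zero) zero = refl
third-comm (suc zero) (suc zero) = refl
third-comm (suc zero) (suc (suc zero)) = refl
third-comm (suc (suc zero)) zero = refl
third-comm (suc (suc zero)) (suc zero) = refl
third-comm (suc (suc zero)) (suc (suc zero)) = refl

third≢ : ∀ {i j} → i ≢ j → third i j ≢ i × third i j ≢ j
third≢ {zero} {suc zero} _ = (λ ()) , (λ ())
third≢ {zero} {suc (suc zero)} _ = (λ ()) , (λ ())
third≢ {suc zero} {zero} _ = (λ ()) , (λ ())
third≢ {suc zero} {suc (suc zero)} _ = (λ ()) , (λ ())
third≢ {suc (suc zero)} {zero} _ = (λ ()) , (λ ())
third≢ {suc (suc zero)} {suc zero} _ = (λ ()) , (λ ())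
third≢ {zero} {zero} i≢j = ⊥-elim (i≢j refl)
third≢ {suc zero} {suc zero} i≢j = ⊥-elim (i≢j refl)
third≢ {suc (suc zero)} {suc (suc zero)} i≢j = ⊥-elim (i≢j refl)

¬Unique₄ : ∀ {w x y z : Fin 3} → ¬ Unique (w ∷ x ∷ y ∷ z ∷ [])
¬Unique₄ = 1+n≰n ∘ unique⇒length≤

third-unique : ∀ {i j k} → i ≢ j → k ≢ i → k ≢ j → k ≡ third i j
third-unique {i} {j} {k} i≢j k≢i k≢j with k Fin.≟ third i j
... | yes k≡third = k≡third
... | no k≢third = ⊥-elim (¬Unique₄
    ((i≢j ∷ ≢-sym k≢i ∷ ≢-sym t≢i ∷ []) ∷ (≢-sym k≢j ∷ ≢-sym t≢j ∷ []) ∷ (k≢third ∷ []) ∷ [] ∷ []))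
  where
  t≢i = proj₁ (third≢ i≢j)
  t≢j = proj₂ (third≢ i≢j)

third-thirdˡ : ∀ {i j} → i ≢ j → third i (third i j) ≡ j
third-thirdˡ i≢j =
  sym (third-unique (≢-sym (proj₁ (third≢ i≢j))) (≢-sym i≢j) (≢-sym (proj₂ (third≢ i≢j))))

third-thirdʳ : ∀ {i j} → i ≢ j → third (third i j) j ≡ i
third-thirdʳ i≢j = sym (third-unique (proj₂ (third≢ i≢j)) (≢-sym (proj₁ (third≢ i≢j))) i≢j)

Leaf : (Fin 3 → ℕ) → Set
Leaf a = Σ (Fin 3) λ i → Fin (a i)

module _ {a : Fin 3 → ℕ} where
  private
    G = K3Leaves a

  ∈-vertices-start : ∀ {u w} (p : Walk G u w) → u ∈ vertices G p
  ∈-vertices-start [ _ ] = here refl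
  ∈-vertices-start (step _ _) = here refl

  walk-to-leaf-visits-root : ∀ {u i l} (p : Walk G u (inj₂ (i , l))) →
    u ≡ inj₂ (i , l) ⊎ inj₁ i ∈ vertices G p
  walk-to-leaf-visits-root [ _ ] = inj₁ refl
  walk-to-leaf-visits-root (step u~v p) with walk-to-leaf-visits-root p | u~v
  ... | inj₂ root∈p | _ = inj₂ (there root∈p)
  ... | inj₁ refl | hang = inj₂ (here refl)

  root≢ : ∀ {i j} → i ≢ j → _≢_ {A = K3V a} (inj₁ i) (inj₁ j)
  root≢ i≢j = i≢j ∘ inj₁-injective

  edge-path : ∀ {u v} → K3Adj a u v → Path G u v
  edge-path u~v = step u~v [ _ ] , ((λ { refl → K3Adj-irrefl u~v }) ∷ []) ∷ [] ∷ []

  root-root-leaf : ∀ {i j} → i ≢ j → ∀ l → Path G (inj₁ i) (inj₂ (j , l))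
  root-root-leaf i≢j _ =
    step (tri i≢j) (step hang [ _ ]) , (root≢ i≢j ∷ (λ ()) ∷ []) ∷ ((λ ()) ∷ []) ∷ [] ∷ []

  root-detour-leaf : ∀ {i j} → i ≢ j → ∀ l → Path G (inj₁ i) (inj₂ (j , l))
  root-detour-leaf i≢j _ =
    step (tri (≢-sym k≢i)) (step (tri k≢j) (step hang [ _ ])) ,
    (root≢ (≢-sym k≢i) ∷ root≢ i≢j ∷ (λ ()) ∷ [])
    ∷ (root≢ k≢j ∷ (λ ()) ∷ []) ∷ ((λ ()) ∷ []) ∷ [] ∷ []
    where
    k≢i = proj₁ (third≢ i≢j)
    k≢j = proj₂ (third≢ i≢j)

  leaf-root-root : ∀ {i j} → i ≢ j → ∀ l → Path G (inj₂ (i , l)) (inj₁ j)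
  leaf-root-root i≢j _ =
    step hang′ (step (tri i≢j) [ _ ]) , ((λ ()) ∷ (λ ()) ∷ []) ∷ (root≢ i≢j ∷ []) ∷ [] ∷ []

  leaf-detour-root : ∀ {i j} → i ≢ j → ∀ l → Path G (inj₂ (i , l)) (inj₁ j)
  leaf-detour-root i≢j _ =
    step hang′ (step (tri (≢-sym k≢i)) (step (tri k≢j) [ _ ])) ,
    ((λ ()) ∷ (λ ()) ∷ (λ ()) ∷ [])
    ∷ (root≢ (≢-sym k≢i) ∷ root≢ i≢j ∷ []) ∷ (root≢ k≢j ∷ []) ∷ [] ∷ []
    where
    k≢i = proj₁ (third≢ i≢j)
    k≢j = proj₂ (third≢ i≢j)

  leaf-root-leaf : ∀ {i} {l m : Fin (a i)} → l ≢ m → Path G (inj₂ (i , l)) (inj₂ (i , m))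
  leaf-root-leaf l≢m =
    step hang′ (step hang [ _ ]) , ((λ ()) ∷ (λ { refl → l≢m refl }) ∷ []) ∷ ((λ ()) ∷ []) ∷ [] ∷ []

  leaf-root-root-leaf : ∀ {i j} → i ≢ j → ∀ l m → Path G (inj₂ (i , l)) (inj₂ (j , m))
  leaf-root-root-leaf i≢j _ _ =
    step hang′ (step (tri i≢j) (step hang [ _ ])) ,
    ((λ ()) ∷ (λ ()) ∷ (λ { refl → i≢j refl }) ∷ [])
    ∷ (root≢ i≢j ∷ (λ ()) ∷ []) ∷ ((λ ()) ∷ []) ∷ [] ∷ []

  leaf-detour-leaf : ∀ {i j} → i ≢ j → ∀ l m → Path G (inj₂ (i , l)) (inj₂ (j , m))
  leaf-detour-leaf i≢j _ _ =
    step hang′ (step (tri (≢-sym k≢i)) (step (tri k≢j) (step hang [ _ ]))) ,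
    ((λ ()) ∷ (λ ()) ∷ (λ ()) ∷ (λ { refl → i≢j refl }) ∷ [])
    ∷ (root≢ (≢-sym k≢i) ∷ root≢ i≢j ∷ (λ ()) ∷ [])
    ∷ (root≢ k≢j ∷ (λ ()) ∷ []) ∷ ((λ ()) ∷ []) ∷ [] ∷ []
    where
    k≢i = proj₁ (third≢ i≢j)
    k≢j = proj₂ (third≢ i≢j)

  module _ {k : ℕ} (c : K3V a → K3V a → Fin k) where

    sibling-path-colours : ∀ {i l m} (p : Walk G (inj₂ (i , l)) (inj₂ (i , m))) → IsPath G p → l ≢ m →
      edgeColours G c p ≡ c (inj₂ (i , l)) (inj₁ i) ∷ c (inj₁ i) (inj₂ (i , m)) ∷ []
    sibling-path-colours [ _ ] _ l≢m = ⊥-elim (l≢m refl)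
    sibling-path-colours (step hang′ (step hang [ _ ])) _ _ = refl
    sibling-path-colours (step hang′ (step hang (step hang′ q))) (_ ∷ root∉ ∷ _) _ =
      ⊥-elim (All.lookup root∉ (there (∈-vertices-start q)) refl)
    sibling-path-colours (step hang′ (step (tri _) q)) (_ ∷ root∉ ∷ _) _ with walk-to-leaf-visits-root q
    ... | inj₁ ()
    ... | inj₂ root∈q = ⊥-elim (All.lookup root∉ root∈q refl)

    root-leaf-path-colours : ∀ {i j′ j m} (r : Walk G (inj₁ j′) (inj₂ (j , m))) → IsPath G r →
      inj₁ i ∉ vertices G r →
      (j′ ≡ j × edgeColours G c r ≡ c (inj₁ j) (inj₂ (j , m)) ∷ [])
      ⊎ (j′ ≢ j × edgeColours G c r ≡ c (inj₁ j′) (inj₁ j) ∷ c (inj₁ j) (inj₂ (j , m)) ∷ [])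
    root-leaf-path-colours (step hang [ _ ]) _ _ = inj₁ (refl , refl)
    root-leaf-path-colours (step hang (step hang′ r)) (root∉ ∷ _) _ =
      ⊥-elim (All.lookup root∉ (there (∈-vertices-start r)) refl)
    root-leaf-path-colours (step (tri j′≢j) (step hang [ _ ])) _ _ = inj₂ (j′≢j , refl)
    root-leaf-path-colours (step (tri _) (step hang (step hang′ r))) (_ ∷ root∉ ∷ _) _ =
      ⊥-elim (All.lookup root∉ (there (∈-vertices-start r)) refl)
    root-leaf-path-colours {i} (step (tri j₁≢j₂) (step (tri j₂≢j₃) r)) (j₁∉ ∷ _) i∉ =
      ⊥-elim (¬Unique₄ {w = i}
        ( ((i∉ ∘ here ∘ cong inj₁) ∷ (i∉ ∘ there ∘ here ∘ cong inj₁)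
           ∷ (λ { refl → i∉ (there (there (∈-vertices-start r))) }) ∷ [])
        ∷ (j₁≢j₂ ∷ (All.lookup j₁∉ (there (∈-vertices-start r)) ∘ cong inj₁) ∷ [])
        ∷ (j₂≢j₃ ∷ []) ∷ [] ∷ []))

    cousin-path-colours : ∀ {i j l m} → i ≢ j → (p : Walk G (inj₂ (i , l)) (inj₂ (j , m))) → IsPath G p →
      let α = c (inj₂ (i , l)) (inj₁ i)
          β = c (inj₁ j) (inj₂ (j , m))
          k = third i j
      in edgeColours G c p ≡ α ∷ c (inj₁ i) (inj₁ j) ∷ β ∷ []
         ⊎ edgeColours G c p ≡ α ∷ c (inj₁ i) (inj₁ k) ∷ c (inj₁ k) (inj₁ j) ∷ β ∷ []
    cousin-path-colours i≢j [ _ ] _ = ⊥-elim (i≢j refl)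
    cousin-path-colours i≢j (step hang′ (step hang [ _ ])) _ = ⊥-elim (i≢j refl)
    cousin-path-colours _ (step hang′ (step hang (step hang′ q))) (_ ∷ root∉ ∷ _) =
      ⊥-elim (All.lookup root∉ (there (∈-vertices-start q)) refl)
    cousin-path-colours {i} i≢j (step hang′ (step (tri i≢j′) r)) (_ ∷ root∉ ∷ r-path)
      with root-leaf-path-colours {i = i} r r-path (λ i∈r → All.lookup root∉ i∈r refl)
    ... | inj₁ (refl , e) = inj₁ (cong (λ cs → _ ∷ _ ∷ cs) e)
    ... | inj₂ (j′≢j , e) with third-unique i≢j (≢-sym i≢j′) j′≢j
    ...   | refl = inj₂ (cong (λ cs → _ ∷ _ ∷ cs) e)

-- Lower bounds

module _ {a : Fin 3 → ℕ} {n : ℕ} (χ : HasLooseColouring (K3Leaves a) n) where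
  private
    G = K3Leaves a
    c = proj₁ χ
    c-sym = proj₁ (proj₂ χ)
    joined = proj₂ (proj₂ χ)

    pendant : (i : Fin 3) → Fin (a i) → Fin n
    pendant i l = c (inj₁ i) (inj₂ (i , l))

  pendant-colours-injective : ∀ i → Injective _≡_ _≡_ (pendant i)
  pendant-colours-injective i {l} {m} e with l Fin.≟ m
  ... | yes l≡m = l≡m
  ... | no l≢m with joined (inj₂ (i , l)) (inj₂ (i , m)) (λ { refl → l≢m refl })
  ...   | p , p-path , p-loose =
    ⊥-elim (Loose-pair⇒≢ (subst Loose (sibling-path-colours c p p-path l≢m) p-loose) (trans (c-sym _ _) e))

  leaves≤colours : ∀ i → a i ≤ n
  leaves≤colours i = Finₚ.injective⇒≤ (pendant-colours-injective i)

  leaf-root-colours : ∀ {i j} (l : Fin (a i)) → i ≢ j → 3 ≤ n ⊎ pendant i l ≢ c (inj₁ i) (inj₁ j)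
  leaf-root-colours {i} {j} l i≢j with joined (inj₂ (i , l)) (inj₁ j) (λ ())
  ... | p , _ , p-loose with loose-nonadjacent G c p (λ { hang′ → i≢j refl }) p-loose
  ...   | inj₁ 3≤n = inj₁ 3≤n
  ...   | inj₂ (_ , hang′ , _ , α≢γ) = inj₂ (α≢γ ∘ trans (c-sym _ _))

  2≤colours : ∀ {i j} → Fin (a i) → i ≢ j → 2 ≤ n
  2≤colours l i≢j with leaf-root-colours l i≢j
  ... | inj₁ 3≤n = <⇒≤ 3≤n
  ... | inj₂ α≢γ = unique⇒length≤ ((α≢γ ∷ []) ∷ [] ∷ [])

  siblings⇒3≤colours : ∀ {i j} {l m : Fin (a i)} → l ≢ m → i ≢ j → 3 ≤ n
  siblings⇒3≤colours {i} {l = l} {m} l≢m i≢j with leaf-root-colours l i≢j | leaf-root-colours m i≢j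
  ... | inj₁ 3≤n | _ = 3≤n
  ... | inj₂ _ | inj₁ 3≤n = 3≤n
  ... | inj₂ αₗ≢γ | inj₂ αₘ≢γ =
    unique⇒length≤ (((l≢m ∘ pendant-colours-injective i) ∷ αₗ≢γ ∷ []) ∷ (αₘ≢γ ∷ []) ∷ [] ∷ [])

  cousins⇒3≤colours : ∀ {i j} → i ≢ j → Fin (a i) → Fin (a j) → 3 ≤ n
  cousins⇒3≤colours {i} {j} i≢j l m with joined (inj₂ (i , l)) (inj₂ (j , m)) (λ { refl → i≢j refl })
  ... | p , _ , p-loose with loose-nonadjacent G c p (λ ()) p-loose
  ...   | inj₁ 3≤n = 3≤n
  ...   | inj₂ (_ , hang′ , hang , _) = ⊥-elim (i≢j refl)

  distinct-leaves⇒3≤colours : ∀ {x y : Leaf a} → x ≢ y → 3 ≤ n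
  distinct-leaves⇒3≤colours {i , l} {j , m} x≢y with i Fin.≟ j
  ... | yes refl =
    siblings⇒3≤colours {j = punchIn i zero} {l} {m} (λ { refl → x≢y refl }) (≢-sym (Finₚ.punchInᵢ≢i i zero))
  ... | no i≢j = cousins⇒3≤colours i≢j l m

  saturated-root⇒2+aⱼ≤colours : ∀ {i j} → n ≤ a i → i ≢ j → Fin (a j) → suc (suc (a j)) ≤ n
  saturated-root⇒2+aⱼ≤colours {i} {j} n≤aᵢ i≢j m₀ = Finₚ.injective⇒≤ palette-injective
    where
    k = third i j
    γ₁ = c (inj₁ i) (inj₁ k)
    γ₂ = c (inj₁ k) (inj₁ j)

    detour-between : ∀ l m → c (inj₂ (i , l)) (inj₁ i) ≡ pendant j m →
      γ₁ ≢ γ₂ × pendant j m ≢ γ₁ × pendant j m ≢ γ₂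
    detour-between l m α≡β with joined (inj₂ (i , l)) (inj₂ (j , m)) (λ { refl → i≢j refl })
    ... | p , p-path , p-loose with cousin-path-colours c i≢j p p-path
    ...   | inj₁ e = ⊥-elim (¬Loose-equal-ends₃ α≡β (subst Loose e p-loose))
    ...   | inj₂ e with Loose-equal-ends₄ α≡β (subst Loose e p-loose)
    ...     | γ₁≢γ₂ , α≢γ₁ , α≢γ₂ = γ₁≢γ₂ , α≢γ₁ ∘ trans α≡β , α≢γ₂ ∘ trans α≡β

    detour : ∀ m → γ₁ ≢ γ₂ × pendant j m ≢ γ₁ × pendant j m ≢ γ₂
    detour m with injective⇒surjective (pendant-colours-injective i) n≤aᵢ (pendant j m)
    ... | l , αₗ≡βₘ = detour-between l m (trans (c-sym _ _) αₗ≡βₘ)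

    palette : Fin (suc (suc (a j))) → Fin n
    palette zero = γ₁
    palette (suc zero) = γ₂
    palette (suc (suc m)) = pendant j m

    palette-injective : Injective _≡_ _≡_ palette
    palette-injective {zero} {zero} _ = refl
    palette-injective {zero} {suc zero} e = ⊥-elim (proj₁ (detour m₀) e)
    palette-injective {zero} {suc (suc m)} e = ⊥-elim (proj₁ (proj₂ (detour m)) (sym e))
    palette-injective {suc zero} {zero} e = ⊥-elim (proj₁ (detour m₀) (sym e))
    palette-injective {suc zero} {suc zero} _ = refl
    palette-injective {suc zero} {suc (suc m)} e = ⊥-elim (proj₂ (proj₂ (detour m)) (sym e))
    palette-injective {suc (suc m)} {zero} e = ⊥-elim (proj₁ (proj₂ (detour m)) e)
    palette-injective {suc (suc m)} {suc zero} e = ⊥-elim (proj₂ (proj₂ (detour m)) e)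
    palette-injective {suc (suc _)} {suc (suc _)} e = cong (λ m → suc (suc m)) (pendant-colours-injective j e)

  heavy-pair⇒suc≤colours : ∀ {i j t} → i ≢ j → a i ≡ t → t ≤ suc (a j) → 2 ≤ t → suc t ≤ n
  heavy-pair⇒suc≤colours {i} {j} {t} i≢j refl t≤1+aⱼ 2≤t with suc t ≤? n
  ... | yes t<n = t<n
  ... | no t≮n =
    ⊥-elim (1+n≰n (≤-trans (saturated-root⇒2+aⱼ≤colours n≤t i≢j m₀) (≤-trans n≤t t≤1+aⱼ)))
    where
    n≤t = ≤-pred (≰⇒> t≮n)
    m₀ = Fin.fromℕ< (≤-pred (≤-trans 2≤t t≤1+aⱼ))

-- Cut-edges

module _ {a : Fin 3 → ℕ} where
  private
    G = K3Leaves a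

  triangle-edge-not-cut : ∀ {i j} → i ≢ j → ¬ IsCutEdge G (inj₁ i) (inj₁ j)
  triangle-edge-not-cut {i} {j} i≢j (_ , no-walk) = no-walk (step i~k (step k~j [ _ ]))
    where
    k = third i j
    k≢i = proj₁ (third≢ i≢j)
    k≢j = proj₂ (third≢ i≢j)
    i~k : Graph._~_ (removeEdge G (inj₁ i) (inj₁ j)) (inj₁ i) (inj₁ k)
    i~k = tri (≢-sym k≢i) ,
      λ { (inj₁ (_ , e)) → k≢j (inj₁-injective e) ; (inj₂ (e , _)) → i≢j (inj₁-injective e) }
    k~j : Graph._~_ (removeEdge G (inj₁ i) (inj₁ j)) (inj₁ k) (inj₁ j)
    k~j = tri k≢j ,
      λ { (inj₁ (e , _)) → k≢i (inj₁-injective e) ; (inj₂ (e , _)) → k≢j (inj₁-injective e) }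

  walk-to-cut-leaf-trivial : ∀ {i l w} → Walk (removeEdge G (inj₁ i) (inj₂ (i , l))) w (inj₂ (i , l)) →
    w ≡ inj₂ (i , l)
  walk-to-cut-leaf-trivial [ _ ] = refl
  walk-to-cut-leaf-trivial (step (u~v , not-removed) p) with walk-to-cut-leaf-trivial p | u~v
  ... | refl | hang = ⊥-elim (not-removed (inj₁ (refl , refl)))

  pendant-cut : ∀ {i l} → IsCutEdge G (inj₁ i) (inj₂ (i , l))
  pendant-cut = hang , λ p → case walk-to-cut-leaf-trivial p of λ ()

  pendant-cut′ : ∀ {i l} → IsCutEdge G (inj₂ (i , l)) (inj₁ i)
  pendant-cut′ = hang′ , λ { (step (hang′ , not-removed) _) → not-removed (inj₁ (refl , refl)) }

  pendantEdge : Leaf a → K3V a × K3V a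
  pendantEdge (i , l) = inj₁ i , inj₂ (i , l)

  cut-edge-pendant : ∀ {u v} → IsCutEdge G u v →
    Σ (Leaf a) λ x → (u , v) ≡ pendantEdge x ⊎ (v , u) ≡ pendantEdge x
  cut-edge-pendant (tri i≢j , no-walk) = ⊥-elim (triangle-edge-not-cut i≢j (tri i≢j , no-walk))
  cut-edge-pendant (hang , _) = _ , inj₁ refl
  cut-edge-pendant (hang′ , _) = _ , inj₂ refl

  cutDegree : K3V a → ℕ
  cutDegree (inj₁ i) = a i
  cutDegree (inj₂ _) = 1

  cutDeg : ∀ b → CutDeg G b (cutDegree b)
  cutDeg (inj₁ i) = tabulate leaf , tabulate⁺ (λ { refl → refl }) , (λ w → mk⇔ to from) , length-tabulate leaf
    where
    leaf : Fin (a i) → K3V a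
    leaf l = inj₂ (i , l)
    to : ∀ {w} → w ∈ tabulate leaf → IsCutEdge G (inj₁ i) w
    to w∈ with ∈-tabulate⁻ w∈
    ... | _ , refl = pendant-cut
    from : ∀ {w} → IsCutEdge G (inj₁ i) w → w ∈ tabulate leaf
    from (tri i≢j , no-walk) = ⊥-elim (triangle-edge-not-cut i≢j (tri i≢j , no-walk))
    from (hang {l = l} , _) = ∈-tabulate⁺ l
  cutDeg (inj₂ (i , l)) =
    inj₁ i ∷ [] , [] ∷ [] ,
    (λ w → mk⇔ (λ { (here refl) → pendant-cut′ }) (λ { (hang′ , _) → here refl })) , refl

  distinct-leaves⇒2≤cut-edges : ∀ {m} → NumCutEdges G m → ∀ {x y : Leaf a} → x ≢ y → 2 ≤ m
  distinct-leaves⇒2≤cut-edges (es , _ , _ , complete , _ , refl) {i , l} {j , m} x≢y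
    with complete _ _ (pendant-cut {i} {l}) | complete _ _ (pendant-cut {j} {m})
  ... | inj₁ x∈ | inj₁ y∈ = distinct-members⇒2≤length x∈ y∈ λ { refl → x≢y refl }
  ... | inj₁ x∈ | inj₂ y∈ = distinct-members⇒2≤length x∈ y∈ λ ()
  ... | inj₂ x∈ | inj₁ y∈ = distinct-members⇒2≤length x∈ y∈ λ ()
  ... | inj₂ x∈ | inj₂ y∈ = distinct-members⇒2≤length x∈ y∈ λ { refl → x≢y refl }

  2≤cut-edges⇒distinct-leaves : ∀ {m} → NumCutEdges G m → 2 ≤ m →
    Σ (Leaf a) λ x → Σ (Leaf a) λ y → x ≢ y
  2≤cut-edges⇒distinct-leaves ([] , _ , _ , _ , _ , refl) ()
  2≤cut-edges⇒distinct-leaves (_ ∷ [] , _ , _ , _ , _ , refl) (s≤s ())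
  2≤cut-edges⇒distinct-leaves
    ((u₁ , v₁) ∷ (u₂ , v₂) ∷ _ , ((e₁≢e₂ ∷ _) ∷ _) , sound , _ , unreversed , refl) _
    with cut-edge-pendant (sound u₁ v₁ (here refl)) | cut-edge-pendant (sound u₂ v₂ (there (here refl)))
  ... | x , inj₁ refl | y , inj₁ refl = x , y , λ { refl → e₁≢e₂ refl }
  ... | x , inj₁ refl | y , inj₂ refl = x , y , λ { refl → unreversed _ _ (here refl) (there (here refl)) }
  ... | x , inj₂ refl | y , inj₁ refl = x , y , λ { refl → unreversed _ _ (here refl) (there (here refl)) }
  ... | x , inj₂ refl | y , inj₂ refl = x , y , λ { refl → e₁≢e₂ refl }

-- Upper bounds

module PendantColouring {a : Fin 3 → ℕ} {n : ℕ}
  (triangle : Fin 3 → Fin n) (triangle-injective : Injective _≡_ _≡_ triangle)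
  (pendant : (i : Fin 3) → Fin (a i) → Fin n) (pendant-injective : ∀ i → Injective _≡_ _≡_ (pendant i))
  (shared-avoids-opposite : ∀ {i j l m} → i ≢ j → pendant i l ≡ pendant j m → pendant j m ≢ triangle i)
  where

  private
    G = K3Leaves a

  colour : K3V a → K3V a → Fin n
  colour (inj₁ i) (inj₁ j) = triangle (third i j)
  colour (inj₁ _) (inj₂ (j , l)) = pendant j l
  colour (inj₂ (j , l)) (inj₁ _) = pendant j l
  colour (inj₂ _) (inj₂ _) = triangle zero  -- never an edge

  colour-sym : ∀ u v → colour u v ≡ colour v u
  colour-sym (inj₁ i) (inj₁ j) = cong triangle (third-comm i j)
  colour-sym (inj₁ _) (inj₂ _) = refl
  colour-sym (inj₂ _) (inj₁ _) = refl
  colour-sym (inj₂ _) (inj₂ _) = refl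

  triangle≢ : ∀ {i j} → i ≢ j → triangle i ≢ triangle j
  triangle≢ i≢j = i≢j ∘ triangle-injective

  detour-colours : ∀ {i j z} → i ≢ j → z ≢ triangle i → z ≢ triangle j →
    let k = third i j in
    colour (inj₁ i) (inj₁ k) ≢ colour (inj₁ k) (inj₁ j)
    × z ≢ colour (inj₁ i) (inj₁ k) × z ≢ colour (inj₁ k) (inj₁ j)
  detour-colours i≢j z≢tᵢ z≢tⱼ rewrite third-thirdˡ i≢j | third-thirdʳ i≢j =
    triangle≢ (≢-sym i≢j) , z≢tⱼ , z≢tᵢ

  opposite-detour-colours : ∀ {i j z} → i ≢ j → z ≡ triangle (third i j) →
    let k = third i j in
    colour (inj₁ i) (inj₁ k) ≢ colour (inj₁ k) (inj₁ j)
    × z ≢ colour (inj₁ i) (inj₁ k) × z ≢ colour (inj₁ k) (inj₁ j)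
  opposite-detour-colours i≢j refl =
    detour-colours i≢j (triangle≢ (proj₁ (third≢ i≢j))) (triangle≢ (proj₂ (third≢ i≢j)))

  root-to-leaf : ∀ {i j} → i ≢ j → ∀ l → LoosePath G colour (inj₁ i) (inj₂ (j , l))
  root-to-leaf {i} {j} i≢j l with pendant j l Fin.≟ triangle (third i j)
  ... | no p≢tₖ = path-loose G (root-root-leaf i≢j l) (inj₂ (inj₁ (_ , _ , refl , ≢-sym p≢tₖ)))
  ... | yes p≡tₖ with opposite-detour-colours i≢j p≡tₖ
  ...   | x≢y , p≢x , p≢y =
    path-loose G (root-detour-leaf i≢j l) (Loose-distinct₀₁₂ x≢y (≢-sym p≢x) (≢-sym p≢y))

  leaf-to-root : ∀ {i j} → i ≢ j → ∀ l → LoosePath G colour (inj₂ (i , l)) (inj₁ j)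
  leaf-to-root {i} {j} i≢j l with pendant i l Fin.≟ triangle (third i j)
  ... | no p≢tₖ = path-loose G (leaf-root-root i≢j l) (inj₂ (inj₁ (_ , _ , refl , p≢tₖ)))
  ... | yes p≡tₖ with opposite-detour-colours i≢j p≡tₖ
  ...   | x≢y , p≢x , p≢y = path-loose G (leaf-detour-root i≢j l) (Loose-distinct₀₁₂ p≢x p≢y x≢y)

  leaf-to-leaf : ∀ {i j} → i ≢ j → ∀ l m → LoosePath G colour (inj₂ (i , l)) (inj₂ (j , m))
  leaf-to-leaf {i} {j} i≢j l m
    with pendant i l Fin.≟ triangle (third i j) | pendant j m Fin.≟ triangle (third i j)
       | pendant i l Fin.≟ pendant j m
  ... | no p≢tₖ | no q≢tₖ | no p≢q =
    path-loose G (leaf-root-root-leaf i≢j l m) (Loose-distinct₀₁₂ p≢tₖ p≢q (≢-sym q≢tₖ))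
  ... | yes p≡tₖ | _ | _ with opposite-detour-colours i≢j p≡tₖ
  ...   | x≢y , p≢x , p≢y = path-loose G (leaf-detour-leaf i≢j l m) (Loose-distinct₀₁₂ p≢x p≢y x≢y)
  leaf-to-leaf {i} {j} i≢j l m | no _ | yes q≡tₖ | _
    with opposite-detour-colours i≢j q≡tₖ
  ... | x≢y , q≢x , q≢y =
    path-loose G (leaf-detour-leaf i≢j l m) (Loose-distinct₁₂₃ x≢y (≢-sym q≢x) (≢-sym q≢y))
  leaf-to-leaf {i} {j} i≢j l m | no _ | no _ | yes p≡q
    with detour-colours i≢j (shared-avoids-opposite i≢j p≡q ∘ trans (sym p≡q))
                            (shared-avoids-opposite (≢-sym i≢j) (sym p≡q))
  ... | x≢y , p≢x , p≢y = path-loose G (leaf-detour-leaf i≢j l m) (Loose-distinct₀₁₂ p≢x p≢y x≢y)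

  loose-path : ∀ u v → u ≢ v → LoosePath G colour u v
  loose-path (inj₁ i) (inj₁ j) u≢v = path-loose G (edge-path (tri (u≢v ∘ cong inj₁))) (inj₁ refl)
  loose-path (inj₁ i) (inj₂ (j , l)) _ with i Fin.≟ j
  ... | yes refl = path-loose G (edge-path hang) (inj₁ refl)
  ... | no i≢j = root-to-leaf i≢j l
  loose-path (inj₂ (i , l)) (inj₁ j) _ with i Fin.≟ j
  ... | yes refl = path-loose G (edge-path hang′) (inj₁ refl)
  ... | no i≢j = leaf-to-root i≢j l
  loose-path (inj₂ (i , l)) (inj₂ (j , m)) x≢y with i Fin.≟ j
  ... | yes refl = path-loose G (leaf-root-leaf l≢m)
                     (inj₂ (inj₁ (_ , _ , refl , l≢m ∘ pendant-injective i)))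
    where
    l≢m : l ≢ m
    l≢m refl = x≢y refl
  ... | no i≢j = leaf-to-leaf i≢j l m

  has-loose-colouring : HasLooseColouring G n
  has-loose-colouring = colour , colour-sym , loose-path

loose-colouring-suc : ∀ {a r} → 2 ≤ r → (∀ i → a i ≤ r) → HasLooseColouring (K3Leaves a) (suc r)
loose-colouring-suc {a} {r} 2≤r a≤r =
  PendantColouring.has-loose-colouring
    triangle triangle-injective pendant pendant-injective shared-avoids-opposite
  where
  triangle : Fin 3 → Fin (suc r)
  triangle i = inject≤ i (s≤s 2≤r)
  triangle-injective : Injective _≡_ _≡_ triangle
  triangle-injective = Finₚ.inject≤-injective _ _ _ _
  pendant : (i : Fin 3) → Fin (a i) → Fin (suc r)
  pendant i l = punchIn (triangle i) (inject≤ l (a≤r i))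
  pendant-injective : ∀ i → Injective _≡_ _≡_ (pendant i)
  pendant-injective i = Finₚ.inject≤-injective _ _ _ _ ∘ Finₚ.punchIn-injective (triangle i) _ _
  shared-avoids-opposite : ∀ {i j l m} → i ≢ j → pendant i l ≡ pendant j m → pendant j m ≢ triangle i
  shared-avoids-opposite {i} _ pᵢ≡pⱼ pⱼ≡tᵢ = Finₚ.punchInᵢ≢i (triangle i) _ (trans pᵢ≡pⱼ pⱼ≡tᵢ)

loose-colouring-heavy-root : ∀ {a r} (i₀ : Fin 3) → 1 ≤ r →
  a i₀ ≤ suc (suc r) → (∀ i → i ≢ i₀ → a i ≤ r) →
  HasLooseColouring (K3Leaves a) (suc (suc r))
loose-colouring-heavy-root {a} {r} i₀ 1≤r aᵢ₀≤ a≤r =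
  PendantColouring.has-loose-colouring
    triangle triangle-injective pendant pendant-injective shared-avoids-opposite
  where
  triangle : Fin 3 → Fin (suc (suc r))
  triangle i = inject≤ i (s≤s (s≤s 1≤r))
  triangle-injective : Injective _≡_ _≡_ triangle
  triangle-injective = Finₚ.inject≤-injective _ _ _ _
  t₀ = triangle i₀

  light : ∀ i → i ≢ i₀ → Fin (a i) → Fin (suc (suc r))
  light i i≢i₀ l =
    punchIn t₀ (punchIn (punchOut (i≢i₀ ∘ sym ∘ triangle-injective)) (inject≤ l (a≤r i i≢i₀)))

  light-injective : ∀ i i≢i₀ → Injective _≡_ _≡_ (light i i≢i₀)
  light-injective i i≢i₀ =
    Finₚ.inject≤-injective _ _ _ _ ∘ Finₚ.punchIn-injective _ _ _ ∘ Finₚ.punchIn-injective t₀ _ _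

  light-avoids : ∀ i i≢i₀ l → light i i≢i₀ l ≢ triangle i × light i i≢i₀ l ≢ t₀
  light-avoids i i≢i₀ l =
    (λ e → Finₚ.punchInᵢ≢i _ _ (Finₚ.punchIn-injective t₀ _ _ (trans e (sym (Finₚ.punchIn-punchOut _))))) ,
    Finₚ.punchInᵢ≢i t₀ _

  pendant : (i : Fin 3) → Fin (a i) → Fin (suc (suc r))
  pendant i with i Fin.≟ i₀
  ... | yes refl = λ l → inject≤ l aᵢ₀≤
  ... | no i≢i₀ = light i i≢i₀

  pendant-injective : ∀ i → Injective _≡_ _≡_ (pendant i)
  pendant-injective i with i Fin.≟ i₀
  ... | yes refl = Finₚ.inject≤-injective _ _ _ _
  ... | no i≢i₀ = light-injective i i≢i₀

  pendant-avoids : ∀ i → i ≢ i₀ → ∀ l → pendant i l ≢ triangle i × pendant i l ≢ t₀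
  pendant-avoids i i≢i₀ l with i Fin.≟ i₀
  ... | yes i≡i₀ = ⊥-elim (i≢i₀ i≡i₀)
  ... | no i≢i₀′ = light-avoids i i≢i₀′ l

  shared-avoids-opposite : ∀ {i j l m} → i ≢ j → pendant i l ≡ pendant j m → pendant j m ≢ triangle i
  shared-avoids-opposite {i} {j} {l} {m} i≢j pᵢ≡pⱼ with i Fin.≟ i₀
  ... | yes refl = proj₂ (pendant-avoids j (≢-sym i≢j) m)
  ... | no i≢i₀ = proj₁ (light-avoids i i≢i₀ l) ∘ trans pᵢ≡pⱼ

loose-colouring-two : ∀ {a} → ((x y : Leaf a) → ¬ x ≢ y) → HasLooseColouring (K3Leaves a) 2
loose-colouring-two {a} at-most-one-leaf = colour , colour-sym , loose-path
  where
  G = K3Leaves a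
  colour : K3V a → K3V a → Fin 2
  colour (inj₁ _) (inj₁ _) = suc zero
  colour _ _ = zero
  colour-sym : ∀ u v → colour u v ≡ colour v u
  colour-sym (inj₁ _) (inj₁ _) = refl
  colour-sym (inj₁ _) (inj₂ _) = refl
  colour-sym (inj₂ _) (inj₁ _) = refl
  colour-sym (inj₂ _) (inj₂ _) = refl
  loose-path : ∀ u v → u ≢ v → LoosePath G colour u v
  loose-path (inj₁ i) (inj₁ j) u≢v = path-loose G (edge-path (tri (u≢v ∘ cong inj₁))) (inj₁ refl)
  loose-path (inj₁ i) (inj₂ (j , l)) _ with i Fin.≟ j
  ... | yes refl = path-loose G (edge-path hang) (inj₁ refl)
  ... | no i≢j = path-loose G (root-root-leaf i≢j l) (inj₂ (inj₁ (_ , _ , refl , λ ())))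
  loose-path (inj₂ (i , l)) (inj₁ j) _ with i Fin.≟ j
  ... | yes refl = path-loose G (edge-path hang′) (inj₁ refl)
  ... | no i≢j = path-loose G (leaf-root-root i≢j l) (inj₂ (inj₁ (_ , _ , refl , λ ())))
  loose-path (inj₂ x) (inj₂ y) x≢y = ⊥-elim (at-most-one-leaf x y (x≢y ∘ cong inj₂))

2t∸1≤n⇒t+t≤1+n : ∀ t {n} → 2 * t ∸ 1 ≤ n → t + t ≤ suc n
2t∸1≤n⇒t+t≤1+n t {n} h = begin
  t + t           ≡⟨ cong (t +_) (sym (+-identityʳ t)) ⟩
  2 * t           ≤⟨ m≤n+m∸n (2 * t) 1 ⟩
  1 + (2 * t ∸ 1) ≤⟨ s≤s h ⟩
  suc n           ∎
  where open ≤-Reasoning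

t≤1+x⇒2t∸1≤t+x : ∀ {t x} → t ≤ suc x → 2 * t ∸ 1 ≤ t + x
t≤1+x⇒2t∸1≤t+x {t} {x} t≤1+x = m≤n+o⇒m∸n≤o (2 * t) 1 (begin
  2 * t       ≡⟨ cong (t +_) (+-identityʳ t) ⟩
  t + t       ≤⟨ +-monoʳ-≤ t t≤1+x ⟩
  t + suc x   ≡⟨ +-suc t x ⟩
  suc (t + x) ∎)
  where open ≤-Reasoning

heavy-pair-split : ∀ {t x y} → x ≤ t → y ≤ t → 2 * t ∸ 1 ≤ x + y →
  (x ≡ t × t ≤ suc y) ⊎ (y ≡ t × t ≤ suc x)
heavy-pair-split {t} {x} {y} x≤t y≤t h with x ≟ t
... | yes refl = inj₁ (refl , +-cancelˡ-≤ x _ _ (≤-trans (2t∸1≤n⇒t+t≤1+n x h) (≤-reflexive (sym (+-suc x y)))))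
... | no x≢t =
  inj₂ (≤-antisym y≤t t≤y , +-cancelʳ-≤ t _ _ (≤-trans (2t∸1≤n⇒t+t≤1+n t h) (s≤s (+-monoʳ-≤ x y≤t))))
  where
  t≤y : t ≤ y
  t≤y = +-cancelˡ-≤ t _ _ (≤-trans (2t∸1≤n⇒t+t≤1+n t h) (+-monoˡ-≤ y (≤∧≢⇒< x≤t x≢t)))

2t∸1≰t+x⇒2+x≤t : ∀ {t x} → ¬ (2 * t ∸ 1 ≤ t + x) → suc (suc x) ≤ t
2t∸1≰t+x⇒2+x≤t {t} {x} not-heavy with suc (suc x) ≤? t
... | yes 2+x≤t = 2+x≤t
... | no 2+x≰t = ⊥-elim (not-heavy (t≤1+x⇒2t∸1≤t+x (≤-pred (≰⇒> 2+x≰t))))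

3≤t⇒2t∸1≰1+t : ∀ {t} → 3 ≤ t → ¬ (2 * t ∸ 1 ≤ suc t)
3≤t⇒2t∸1≰1+t {t} 3≤t h = ≤⇒≯ (+-cancelʳ-≤ t t 2 (2t∸1≤n⇒t+t≤1+n t h)) 3≤t

HeavyRoots : ℕ → (Fin 3 → ℕ) → Set
HeavyRoots t a = ∃₂ λ i j → i ≢ j × 2 * t ∸ 1 ≤ a i + a j

heavy-roots? : ∀ t a → Dec (HeavyRoots t a)
heavy-roots? t a = Finₚ.any? λ i → Finₚ.any? λ j → ¬? (i Fin.≟ j) ×-dec (2 * t ∸ 1 ≤? a i + a j)

HeavyRoots⇒TwoHeavy : ∀ {t a} → HeavyRoots t a → TwoHeavy (K3Leaves a) t
HeavyRoots⇒TwoHeavy (i , j , i≢j , h) =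
  inj₁ i , inj₁ j , root≢ i≢j , _ , _ , cutDeg (inj₁ i) , cutDeg (inj₁ j) , h

TwoHeavy⇒HeavyRoots : ∀ {t a} → 3 ≤ t → (∀ i → a i ≤ t) → TwoHeavy (K3Leaves a) t → HeavyRoots t a
TwoHeavy⇒HeavyRoots {t} {a} 3≤t a≤t (b₁ , b₂ , b₁≢b₂ , _ , _ , deg₁ , deg₂ , h)
  with CutDeg-functional _ deg₁ (cutDeg b₁) | CutDeg-functional _ deg₂ (cutDeg b₂)
... | refl | refl = roots b₁ b₂ b₁≢b₂ h
  where
  roots : ∀ u v → u ≢ v → 2 * t ∸ 1 ≤ cutDegree u + cutDegree v → HeavyRoots t a
  roots (inj₁ i) (inj₁ j) u≢v heavy = i , j , u≢v ∘ cong inj₁ , heavy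
  roots (inj₁ i) (inj₂ _) _ heavy =
    ⊥-elim (3≤t⇒2t∸1≰1+t 3≤t (≤-trans heavy (≤-trans (+-monoˡ-≤ 1 (a≤t i)) (≤-reflexive (+-comm t 1)))))
  roots (inj₂ _) (inj₁ j) _ heavy = ⊥-elim (3≤t⇒2t∸1≰1+t 3≤t (≤-trans heavy (s≤s (a≤t j))))
  roots (inj₂ _) (inj₂ _) _ heavy =
    ⊥-elim (3≤t⇒2t∸1≰1+t 3≤t (≤-trans heavy (s≤s (≤-trans (s≤s z≤n) 3≤t))))

lec-of-large-type : ∀ {t a} → 3 ≤ t → IsTypeK3 t a →
  Σ ℕ λ k → IsLec (K3Leaves a) k × t ≤ k × k ≤ suc t × ((k ≡ suc t) ⇔ TwoHeavy (K3Leaves a) t)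
lec-of-large-type {t} {a} 3≤t@(s≤s (s≤s (s≤s _))) (a≤t , i₀ , aᵢ₀≡t) with heavy-roots? t a
... | yes heavy@(i , j , i≢j , h) =
  suc t , (loose-colouring-suc (<⇒≤ 3≤t) a≤t , lower) , n≤1+n t , ≤-refl ,
  mk⇔ (λ _ → HeavyRoots⇒TwoHeavy {t} heavy) (λ _ → refl)
  where
  lower : ∀ n → HasLooseColouring (K3Leaves a) n → suc t ≤ n
  lower n χ with heavy-pair-split (a≤t i) (a≤t j) h
  ... | inj₁ (aᵢ≡t , t≤1+aⱼ) = heavy-pair⇒suc≤colours χ i≢j aᵢ≡t t≤1+aⱼ (<⇒≤ 3≤t)
  ... | inj₂ (aⱼ≡t , t≤1+aᵢ) = heavy-pair⇒suc≤colours χ (≢-sym i≢j) aⱼ≡t t≤1+aᵢ (<⇒≤ 3≤t)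
... | no light =
  t , (colouring , λ n χ → subst (_≤ n) aᵢ₀≡t (leaves≤colours χ i₀)) , ≤-refl , n≤1+n t ,
  mk⇔ (λ t≡1+t → ⊥-elim (1+n≰n (≤-reflexive (sym t≡1+t))))
      (⊥-elim ∘ light ∘ TwoHeavy⇒HeavyRoots 3≤t a≤t)
  where
  light-root : ∀ i → i ≢ i₀ → suc (suc (a i)) ≤ t
  light-root i i≢i₀ = 2t∸1≰t+x⇒2+x≤t λ h →
    light (i₀ , i , ≢-sym i≢i₀ , subst (λ x → 2 * t ∸ 1 ≤ x + a i) (sym aᵢ₀≡t) h)
  colouring : HasLooseColouring (K3Leaves a) t
  colouring = loose-colouring-heavy-root i₀ (s≤s z≤n) (≤-reflexive aᵢ₀≡t)
    (λ i i≢i₀ → ≤-pred (≤-pred (light-root i i≢i₀)))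

lemma2 : (t : ℕ) (a : Fin 3 → ℕ) → IsTypeK3 t a →
    ((t ≡ 1) → NumCutEdges (K3Leaves a) 1 → IsLec (K3Leaves a) 2)
    × ((t ≤ 2) → (m : ℕ) → NumCutEdges (K3Leaves a) m → 2 ≤ m → IsLec (K3Leaves a) 3)
    × (3 ≤ t → Σ ℕ λ k → IsLec (K3Leaves a) k × t ≤ k × k ≤ suc t
         × ((k ≡ suc t) ⇔ TwoHeavy (K3Leaves a) t))
lemma2 t a type-t@(a≤t , i₀ , aᵢ₀≡t) = one-cut-edge , several-cut-edges , λ 3≤t → lec-of-large-type 3≤t type-t
  where
  G = K3Leaves a

  one-cut-edge : t ≡ 1 → NumCutEdges G 1 → IsLec G 2
  one-cut-edge refl cuts =
    loose-colouring-two (λ _ _ x≢y → 1+n≰n (distinct-leaves⇒2≤cut-edges cuts x≢y)) ,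
    λ n χ → 2≤colours χ (subst Fin (sym aᵢ₀≡t) zero) (≢-sym (Finₚ.punchInᵢ≢i i₀ zero))

  several-cut-edges : t ≤ 2 → ∀ m → NumCutEdges G m → 2 ≤ m → IsLec G 3
  several-cut-edges t≤2 m cuts 2≤m with 2≤cut-edges⇒distinct-leaves cuts 2≤m
  ... | _ , _ , x≢y =
    loose-colouring-suc ≤-refl (λ i → ≤-trans (a≤t i) t≤2) , λ n χ → distinct-leaves⇒3≤colours χ x≢y
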